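{- Let $0<\delta<\tfrac12$, let $k=\left\lfloor \frac{2}{1-2\delta}\right\rfloor$ and \[ p=-\frac{1}{2k}+\sqrt{\frac{1}{4k^2}+\frac{1-2\delta}{k}}. \] Then no deterministic online algorithm for the Online Simple Knapsack problem with item size estimates and additive estimate accuracy $\delta$ has competitive ratio smaller than $\frac1p$; that is, every such algorithm has competitive ratio at least $\frac1p$.
   Context: Online Simple Knapsack with Item Size Estimates (additive accuracy $\delta\ge 0$): an instance consists of actual item sizes $x_1,\dots,x_n\in[0,1]$ together with estimated sizes $x_1',\dots,x_n'$ satisfying $x_i'-\delta\le x_i\le x_i'+\delta$ for all $i$. A deterministic online algorithm knows $\delta$ and the whole list of estimates $x_1',\dots,x_n'$ from the start. The actual sizes are then revealed one at a time in order. When $x_i$ is revealed, the algorithm must irrevocably either pack it into an initially empty knapsack of capacity $1$ (allowed only if the total size already packed plus $x_i$ is at most $1$) or reject it. The gain of an algorithm is the total size of the packed items. The optimal gain $\mathrm{OPT}$ of an instance is the maximum total size of a subset of the actual items with total size at most $1$. The competitive ratio of an algorithm $A$ is $\sup \mathrm{OPT}/\mathrm{gain}_A$, the supremum over all instances with accuracy $\delta$ (with any number of items and any estimates).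
   Formalization: The accuracy δ ranges only over the rationals, and the actual item sizes and their estimates are taken in the rationals. -}

module Defs where

open import Data.Bool using (Bool; true; false; if_then_else_; _∧_)
open import Data.List using (List; []; _∷_; _++_; [_]; foldr; filter; map)
open import Data.Nat using (ℕ)
open import Data.Vec using (Vec; toList)
open import Data.Rational using (ℚ; 0ℚ; 1ℚ; _+_; _*_; _-_; _≤ᵇ_; _⊔_)

-- A deterministic online algorithm (for a fixed, known δ): given the full
-- list of estimates and the list of actual sizes revealed so far (in order,
-- the last one being the current item), it decides whether to pack (true)
-- or reject (false) the current item.  Earlier decisions are a function of
-- the same data, so they need not be passed explicitly.
Algorithm : Set
Algorithm = List ℚ → List ℚ → Bool

-- Run the algorithm: `run A est hist load xs` processes the remaining
-- actual sizes xs; an item is packed iff the algorithm says so and it fits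
-- (a request to pack an item that does not fit is treated as a rejection).
run : Algorithm → List ℚ → List ℚ → ℚ → List ℚ → ℚ
run A est hist load [] = load
run A est hist load (x ∷ xs) =
  let h = hist ++ [ x ] in
  if A est h ∧ ((load + x) ≤ᵇ 1ℚ)
  then run A est h (load + x) xs
  else run A est h load xs

gain : Algorithm → {n : ℕ} → Vec ℚ n → Vec ℚ n → ℚ
gain A est act = run A (toList est) [] 0ℚ (toList act)

sublists : List ℚ → List (List ℚ)
sublists [] = [] ∷ []
sublists (x ∷ xs) = let r = sublists xs in map (x ∷_) r ++ r

sumℚ : List ℚ → ℚ
sumℚ = foldr _+_ 0ℚ

OPT : {n : ℕ} → Vec ℚ n → ℚ
OPT act = foldr (λ s m → if sumℚ s ≤ᵇ 1ℚ then sumℚ s ⊔ m else m) 0ℚ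
                (sublists (toList act))

-- The adversary watches the algorithm's decisions.  Write m = 1 - 2δ and U = 1 - c + d.  It first
-- offers up to k large items c.  If all are rejected, n items of size 0 and a last item U - 2δ
-- follow: the gain is at most U - 2δ, while the k large items fit and give k c > (U - 2δ)/q.
-- Once a large item is packed, the remaining large ones become v, which has the same estimate as c
-- but either no longer fits next to c or has size 0; then come n small items d = c/(n+1) and a
-- last item U.  If a small item is packed, the rest collapses to zeros and 1 - c, so the gain is
-- c + d < q while c and 1 - c fill the knapsack; otherwise U does not fit, the gain is c < q, and
-- the small items with U fill the knapsack.  The large size must satisfy
-- m/(1 + q k) < c < min(q, 1/k), and also c > m/2 when k m < 2 (then v = c + 2δ is blocked) or
-- c ≤ 2δ when k m = 2 (then v = 0); these bounds are compatible because q exceeds the positive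
-- root of k x² + x = m.  Finally d is chosen small enough.

module Submission where

open import Defs
open import Data.Bool using (true; false; _∧_; T; if_then_else_)
open import Data.Empty using (⊥-elim)
open import Data.Fin using (Fin)
open import Data.Integer using (+_; +[1+_])
import Data.Integer as ℤ
import Data.Integer.Properties as ℤ
import Data.Integer.Tactic.RingSolver as ℤ-Solver
open import Data.List using (List; []; _∷_; [_]; map; foldr) renaming (_++_ to _++ˡ_)
open import Data.List.Membership.Propositional using (_∈_)
open import Data.List.Membership.Propositional.Properties using (∈-map⁺; ∈-++⁺ˡ; ∈-++⁺ʳ)
open import Data.List.Relation.Binary.Sublist.Propositional using (_⊆_; []; _∷_; _∷ʳ_; minimum)
open import Data.List.Relation.Unary.Any using (here; there)
open import Data.Nat using (ℕ; zero; suc; s≤s) renaming (_+_ to _+ℕ_; _*_ to _*ℕ_; _≤_ to _≤ℕ_; _<_ to _<ℕ_)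
import Data.Nat.Properties as ℕ
import Data.Nat.Coprimality as Coprime
open import Data.Product using (Σ; ∃-syntax; _×_; _,_; proj₁; proj₂)
open import Data.Rational
  using (ℚ; mkℚ; 0ℚ; 1ℚ; ½; _+_; _*_; _-_; -_; _÷_; 1/_; _/_; _⊓_; _⊔_; _≤_; _<_; _≤ᵇ_; *≤*; *<*; NonZero; positive; nonNegative)
open import Data.Rational.Properties
open import Data.Rational.Solver
import Data.Rational.Unnormalised as ℚᵘ
import Data.Rational.Unnormalised.Properties as ℚᵘ
open import Data.Sum using (_⊎_; inj₁; inj₂; [_,_]′)
import Data.Sum as Sum
open import Data.Unit using (tt)
open import Data.Vec using (Vec; lookup; []; _∷_; replicate; toList) renaming (_++_ to _++ᵛ_; [_] to [_]ᵛ)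
open import Data.Vec.Relation.Binary.Pointwise.Inductive as Pointwise using (Pointwise; []; _∷_)
open import Function using (_∘_)
open import Relation.Binary.Definitions using (tri<; tri≈; tri>)
open import Relation.Binary.PropositionalEquality using (_≡_; refl; sym; trans; cong; subst; subst₂; module ≡-Reasoning)
open import Relation.Nullary using (¬_)

open +-*-Solver

fromℕ : ℕ → ℚ
fromℕ n = mkℚ (+ n) 0 (Coprime.sym (Coprime.1-coprimeTo n))

fromℕ≡/1 : ∀ n → + n / 1 ≡ fromℕ n
fromℕ≡/1 n = normalize-coprime _

fromℕ-suc : ∀ n → fromℕ (suc n) ≡ 1ℚ + fromℕ n
fromℕ-suc n = toℚᵘ-injective (ℚᵘ.≃-trans (ℚᵘ.*≡* (identity (+ n))) (ℚᵘ.≃-sym (toℚᵘ-homo-+ 1ℚ (fromℕ n))))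
  where
  identity : ∀ x → (+ 1 ℤ.+ x) ℤ.* + 1 ≡ (+ 1 ℤ.* + 1 ℤ.+ x ℤ.* + 1) ℤ.* + 1
  identity = ℤ-Solver.solve-∀

fromℕ-suc-* : ∀ n x → fromℕ (suc n) * x ≡ fromℕ n * x + x
fromℕ-suc-* n x = trans (cong (_* x) (fromℕ-suc n)) (solve 2 (λ m x → (con 1ℚ :+ m) :* x := m :* x :+ x) refl (fromℕ n) x)

fromℕ-mono-≤ : ∀ {m n} → m ≤ℕ n → fromℕ m ≤ fromℕ n
fromℕ-mono-≤ m≤n = *≤* (ℤ.*-monoʳ-≤-nonNeg (+ 1) (ℤ.+≤+ m≤n))

0≤fromℕ : ∀ n → 0ℚ ≤ fromℕ n
0≤fromℕ n = nonNegative⁻¹ (fromℕ n)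

0<fromℕ-suc : ∀ n → 0ℚ < fromℕ (suc n)
0<fromℕ-suc n = positive⁻¹ (fromℕ (suc n))

<⇒≱ : ∀ {p q} → p < q → ¬ q ≤ p
<⇒≱ p<q q≤p = <-irrefl refl (<-≤-trans p<q q≤p)

p<q⇒0<q-p : ∀ {p q} → p < q → 0ℚ < q - p
p<q⇒0<q-p {p} {q} p<q = subst (_< q - p) (+-inverseʳ p) (+-monoˡ-< (- p) p<q)

p≤q⇒0≤q-p : ∀ {p q} → p ≤ q → 0ℚ ≤ q - p
p≤q⇒0≤q-p {p} {q} p≤q = subst (_≤ q - p) (+-inverseʳ p) (+-monoˡ-≤ (- p) p≤q)

q-p+p≡q : ∀ p q → q - p + p ≡ q
q-p+p≡q = solve 2 (λ p q → q :- p :+ p := q) refl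

<-byGap : ∀ {p q} t → 0ℚ < t → q - p ≡ t → p < q
<-byGap {p} {q} t t>0 q-p≡t =
  subst₂ _<_ (+-identityˡ p) (q-p+p≡q p q) (+-monoˡ-< p (subst (0ℚ <_) (sym q-p≡t) t>0))

≤-byGap : ∀ {p q} t → 0ℚ ≤ t → q - p ≡ t → p ≤ q
≤-byGap {p} {q} t t≥0 q-p≡t =
  subst₂ _≤_ (+-identityˡ p) (q-p+p≡q p q) (+-monoˡ-≤ p (subst (0ℚ ≤_) (sym q-p≡t) t≥0))

*-pos : ∀ {p q} → 0ℚ < p → 0ℚ < q → 0ℚ < p * q
*-pos {p} {q} p>0 q>0 = subst (_< p * q) (*-zeroˡ q) (*-monoˡ-<-pos q {{positive q>0}} p>0)

*-nonNeg : ∀ {p q} → 0ℚ ≤ p → 0ℚ ≤ q → 0ℚ ≤ p * q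
*-nonNeg {p} {q} p≥0 q≥0 = subst (_≤ p * q) (*-zeroˡ q) (*-monoʳ-≤-nonNeg q {{nonNegative q≥0}} p≥0)

<-⊓ : ∀ {p q r} → p < q → p < r → p < q ⊓ r
<-⊓ {p} {q} {r} p<q p<r with ⊓-sel q r
... | inj₁ q⊓r≡q = subst (p <_) (sym q⊓r≡q) p<q
... | inj₂ q⊓r≡r = subst (p <_) (sym q⊓r≡r) p<r

⊔-< : ∀ {p q r} → p < r → q < r → p ⊔ q < r
⊔-< {p} {q} {r} p<r q<r with ⊔-sel p q
... | inj₁ p⊔q≡p = subst (_< r) (sym p⊔q≡p) p<r
... | inj₂ p⊔q≡q = subst (_< r) (sym p⊔q≡q) q<r

0≤1 : 0ℚ ≤ 1ℚ
0≤1 = nonNegative⁻¹ 1ℚ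

quad : ℚ → ℚ → ℚ
quad a x = a * (x * x) + x

quad-mono-≤ : ∀ {a x y} → 0ℚ ≤ a → 0ℚ ≤ x → x ≤ y → quad a x ≤ quad a y
quad-mono-≤ {a} {x} {y} a≥0 x≥0 x≤y =
  ≤-byGap _ (*-nonNeg (p≤q⇒0≤q-p x≤y) (+-mono-≤ (*-nonNeg a≥0 (+-mono-≤ x≥0 (≤-trans x≥0 x≤y))) 0≤1))
    (solve 3 (λ a x y → (a :* (y :* y) :+ y) :- (a :* (x :* x) :+ x) := (y :- x) :* (a :* (x :+ y) :+ con 1ℚ)) refl a x y)

quad-cancel-< : ∀ {a x y} → 0ℚ ≤ a → 0ℚ ≤ y → quad a x < quad a y → x < y
quad-cancel-< a≥0 y≥0 ax<ay = ≰⇒> (λ y≤x → <⇒≱ ax<ay (quad-mono-≤ a≥0 y≥0 y≤x))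

module _ {r : ℚ} (r>0 : 0ℚ < r) where
  private instance
    r≢0 : NonZero r
    r≢0 = pos⇒nonZero r {{positive r>0}}

  divide : ℚ → ℚ
  divide p = p ÷ r

  divide-*-cancel : ∀ p → divide p * r ≡ p
  divide-*-cancel p = begin
    p * 1/ r * r    ≡⟨ *-assoc p (1/ r) r ⟩
    p * (1/ r * r)  ≡⟨ cong (p *_) (*-inverseˡ r) ⟩
    p * 1ℚ          ≡⟨ *-identityʳ p ⟩
    p               ∎
    where open ≡-Reasoning

  divide-*-comm : ∀ p s → divide p * s ≡ divide (p * s)
  divide-*-comm p s = solve 3 (λ p x s → p :* x :* s := p :* s :* x) refl p (1/ r) s

  private
    r≥0 : 0ℚ ≤ r
    r≥0 = <⇒≤ r>0

  divide-< : ∀ {p q} → p < q * r → divide p < q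
  divide-< {p} {q} p<qr = *-cancelʳ-<-nonNeg r {{nonNegative r≥0}} (subst (_< q * r) (sym (divide-*-cancel p)) p<qr)

  <-divide : ∀ {p q} → p * r < q → p < divide q
  <-divide {p} {q} pr<q = *-cancelʳ-<-nonNeg r {{nonNegative r≥0}} (subst (p * r <_) (sym (divide-*-cancel q)) pr<q)

  divide-<⁻¹ : ∀ {p q} → divide p < q → p < q * r
  divide-<⁻¹ {p} {q} p/r<q = subst (_< q * r) (divide-*-cancel p) (*-monoˡ-<-pos r {{positive r>0}} p/r<q)

  <-divide⁻¹ : ∀ {p q} → p < divide q → p * r < q
  <-divide⁻¹ {p} {q} p<q/r = subst (p * r <_) (divide-*-cancel q) (*-monoˡ-<-pos r {{positive r>0}} p<q/r)

unitFraction-< : ∀ {ε} → 0ℚ < ε → Σ ℕ λ n → Σ ℚ λ z → (fromℕ (suc n) * z ≡ 1ℚ) × (0ℚ < z) × (z < ε)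
unitFraction-< {mkℚ +[1+ a ] b _} ε>0 =
  suc b , z , *-inverseʳ (fromℕ (suc (suc b))) , positive⁻¹ z , *<* (ℤ.+<+ 1+b<[1+a][2+b])
  where
  z : ℚ
  z = mkℚ (+ 1) (suc b) (Coprime.1-coprimeTo _)
  1+b<[1+a][2+b] : 1 *ℕ suc b <ℕ suc a *ℕ suc (suc b)
  1+b<[1+a][2+b] = ℕ.<-≤-trans (s≤s (s≤s (ℕ.≤-reflexive (ℕ.+-identityʳ b)))) (ℕ.m≤n*m (suc (suc b)) (suc a))
unitFraction-< {mkℚ (+ 0) b _} (*<* (ℤ.+<+ ()))
unitFraction-< {mkℚ ℤ.-[1+ a ] b _} (*<* ())

⊆⇒∈-sublists : ∀ {s xs} → s ⊆ xs → s ∈ sublists xs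
⊆⇒∈-sublists [] = here refl
⊆⇒∈-sublists {xs = x ∷ xs} (refl ∷ s⊆xs) = ∈-++⁺ˡ (∈-map⁺ (x ∷_) (⊆⇒∈-sublists s⊆xs))
⊆⇒∈-sublists {xs = x ∷ xs} (x ∷ʳ s⊆xs) = ∈-++⁺ʳ (map (x ∷_) (sublists xs)) (⊆⇒∈-sublists s⊆xs)

bestFitting : List (List ℚ) → ℚ
bestFitting = foldr (λ s m → if sumℚ s ≤ᵇ 1ℚ then sumℚ s ⊔ m else m) 0ℚ

fitting≤bestFitting : ∀ {ss s} → s ∈ ss → sumℚ s ≤ 1ℚ → sumℚ s ≤ bestFitting ss
fitting≤bestFitting {s ∷ ss} (here refl) s≤1 with sumℚ s ≤ᵇ 1ℚ | ≤⇒≤ᵇ s≤1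
... | true | _ = p≤p⊔q (sumℚ s) (bestFitting ss)
fitting≤bestFitting {t ∷ ss} (there s∈ss) s≤1 with sumℚ t ≤ᵇ 1ℚ
... | true  = ≤-trans (fitting≤bestFitting s∈ss s≤1) (p≤q⊔p (sumℚ t) (bestFitting ss))
... | false = fitting≤bestFitting s∈ss s≤1

≤OPT : ∀ {n} (act : Vec ℚ n) {s} → s ⊆ toList act → sumℚ s ≤ 1ℚ → sumℚ s ≤ OPT act
≤OPT act s⊆act s≤1 = fitting≤bestFitting (⊆⇒∈-sublists s⊆act) s≤1

∧-fits⇒≤ : ∀ {a} L x → a ∧ (L + x ≤ᵇ 1ℚ) ≡ true → L + x ≤ 1ℚ
∧-fits⇒≤ {true} _ _ fits = ≤ᵇ⇒≤ (subst T (sym fits) tt)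

ValidItem : ℚ → ℚ → ℚ → Set
ValidItem δ e x = (0ℚ ≤ x) × (x ≤ 1ℚ) × (e - δ ≤ x) × (x ≤ e + δ)

record Parameters (δ q : ℚ) (k : ℕ) : Set where
  field
    c d v e : ℚ
    n : ℕ
    d>0 : 0ℚ < d
    d≤2δ : d ≤ δ + δ
    c≤1-2δ : c ≤ 1ℚ - (δ + δ)
    [n+1]d≡c : fromℕ (suc n) * d ≡ c
    c+d<q : c + d < q
    kc≤1 : fromℕ k * c ≤ 1ℚ
    rejecting-loses : 1ℚ - c + d - (δ + δ) < q * (fromℕ k * c)
    v-blocked : 1ℚ < c + v ⊎ v ≡ 0ℚ
    c-valid : ValidItem δ e c
    v-valid : ValidItem δ e v

module Adversary (A : Algorithm) {δ q : ℚ} {k : ℕ} (P : Parameters δ q k) where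
  open Parameters P

  U : ℚ
  U = 1ℚ - c + d

  estimates : Vec ℚ (k +ℕ (n +ℕ 1))
  estimates = replicate k e ++ᵛ (replicate n δ ++ᵛ [ U - δ ]ᵛ)

  E : List ℚ
  E = toList estimates

  zerosThen : (r : ℕ) → ℚ → Vec ℚ (r +ℕ 1)
  zerosThen r x = replicate r 0ℚ ++ᵛ [ x ]ᵛ

  -- The sizes are produced by simulating A: h is the history revealed so far, L the current load.
  smallPhase : (r : ℕ) → List ℚ → ℚ → Vec ℚ (r +ℕ 1)
  smallPhase zero    h L = U ∷ []
  smallPhase (suc r) h L =
    d ∷ (if A E (h ++ˡ [ d ]) ∧ (L + d ≤ᵇ 1ℚ)
         then zerosThen r (U - d)
         else smallPhase r (h ++ˡ [ d ]) L)

  blockedPhase : (r : ℕ) → List ℚ → ℚ → Vec ℚ (r +ℕ (n +ℕ 1))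
  blockedPhase zero    h L = smallPhase n h L
  blockedPhase (suc r) h L =
    v ∷ blockedPhase r (h ++ˡ [ v ]) (if A E (h ++ˡ [ v ]) ∧ (L + v ≤ᵇ 1ℚ) then L + v else L)

  largePhase : (r : ℕ) → List ℚ → Vec ℚ (r +ℕ (n +ℕ 1))
  largePhase zero    h = zerosThen n (U - (δ + δ))
  largePhase (suc r) h =
    c ∷ (if A E (h ++ˡ [ c ]) ∧ (0ℚ + c ≤ᵇ 1ℚ)
         then blockedPhase r (h ++ˡ [ c ]) (0ℚ + c)
         else largePhase r (h ++ˡ [ c ]))

  actual : Vec ℚ (k +ℕ (n +ℕ 1))
  actual = largePhase k []

  c≥0 : 0ℚ ≤ c
  c≥0 = proj₁ c-valid

  c≤1 : c ≤ 1ℚ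
  c≤1 = proj₁ (proj₂ c-valid)

  d≥0 : 0ℚ ≤ d
  d≥0 = <⇒≤ d>0

  2δ≥0 : 0ℚ ≤ δ + δ
  2δ≥0 = ≤-trans d≥0 d≤2δ

  c≡[1+n]d : c ≡ (1ℚ + fromℕ n) * d
  c≡[1+n]d = trans (sym [n+1]d≡c) (cong (_* d) (fromℕ-suc n))

  d≤c : d ≤ c
  d≤c = ≤-byGap (fromℕ n * d) (*-nonNeg (0≤fromℕ n) d≥0) (begin
    c - d                       ≡⟨ cong (_- d) c≡[1+n]d ⟩
    (1ℚ + fromℕ n) * d - d      ≡⟨ solve 2 (λ m d → (con 1ℚ :+ m) :* d :- d := m :* d) refl (fromℕ n) d ⟩
    fromℕ n * d                 ∎)
    where open ≡-Reasoning

  c<q : c < q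
  c<q = ≤-<-trans (≤-byGap d d≥0 (solve 2 (λ c d → c :+ d :- c := d) refl c d)) c+d<q

  q≥0 : 0ℚ ≤ q
  q≥0 = <⇒≤ (≤-<-trans c≥0 c<q)

  nd+U≡1 : fromℕ n * d + (U + 0ℚ) ≡ 1ℚ
  nd+U≡1 = begin
    fromℕ n * d + (1ℚ - c + d + 0ℚ)                   ≡⟨ cong (λ x → fromℕ n * d + (1ℚ - x + d + 0ℚ)) c≡[1+n]d ⟩
    fromℕ n * d + (1ℚ - (1ℚ + fromℕ n) * d + d + 0ℚ)  ≡⟨ solve 2 (λ m d → m :* d :+ (con 1ℚ :- (con 1ℚ :+ m) :* d :+ d :+ con 0ℚ) := con 1ℚ) refl (fromℕ n) d ⟩
    1ℚ                                                ∎
    where open ≡-Reasoning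

  c+[U-d]≡1 : c + (U - d + 0ℚ) ≡ 1ℚ
  c+[U-d]≡1 = solve 2 (λ c d → c :+ (con 1ℚ :- c :+ d :- d :+ con 0ℚ) := con 1ℚ) refl c d

  U-2δ≥0 : 0ℚ ≤ U - (δ + δ)
  U-2δ≥0 = ≤-byGap _ (+-mono-≤ (p≤q⇒0≤q-p c≤1-2δ) d≥0)
    (solve 3 (λ c d δ → con 1ℚ :- c :+ d :- (δ :+ δ) :- con 0ℚ := (con 1ℚ :- (δ :+ δ) :- c) :+ d) refl c d δ)

  record Beaten (B : ℚ) (xs : List ℚ) (g : ℚ) : Set where
    constructor beaten
    field
      {chosen}  : List ℚ
      chosen⊆xs : chosen ⊆ xs
      fits      : B + sumℚ chosen ≤ 1ℚ
      beats     : g < q * (B + sumℚ chosen)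

  take : ∀ {B x xs g} → Beaten (B + x) xs g → Beaten B (x ∷ xs) g
  take {B} {x} {g = g} (beaten {s} s⊆xs fits beats) =
    beaten (refl ∷ s⊆xs) (subst (_≤ 1ℚ) (+-assoc B x (sumℚ s)) fits)
                         (subst (λ t → g < q * t) (+-assoc B x (sumℚ s)) beats)

  pass : ∀ {B x xs g} → Beaten B xs g → Beaten B (x ∷ xs) g
  pass {x = x} (beaten s⊆xs fits beats) = beaten (x ∷ʳ s⊆xs) fits beats

  beaten-by-prefix : ∀ {B xs g} → B ≤ 1ℚ → g < q * B → Beaten B xs g
  beaten-by-prefix {B} {xs} {g} B≤1 g<qB =
    beaten (minimum xs) (subst (_≤ 1ℚ) (sym (+-identityʳ B)) B≤1)
                        (subst (λ t → g < q * t) (sym (+-identityʳ B)) g<qB)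

  beaten-cong : ∀ {B B′ xs g} → B ≡ B′ → Beaten B xs g → Beaten B′ xs g
  beaten-cong refl G = G

  Loses : ℚ → List ℚ → ℚ → List ℚ → Set
  Loses B h L xs = Beaten B xs (run A E h L xs)

  beats-with-1 : ∀ {g} → g < q → g < q * 1ℚ
  beats-with-1 {g} = subst (g <_) (sym (*-identityʳ q))

  zerosThen-gain : ∀ r h {x} → 0ℚ ≤ x → run A E h 0ℚ (toList (zerosThen r x)) ≤ x
  zerosThen-gain zero h {x} x≥0 with A E (h ++ˡ [ x ]) ∧ (0ℚ + x ≤ᵇ 1ℚ)
  ... | true  = ≤-reflexive (+-identityˡ x)
  ... | false = x≥0
  zerosThen-gain (suc r) h x≥0 with A E (h ++ˡ [ 0ℚ ]) ∧ (0ℚ + 0ℚ ≤ᵇ 1ℚ)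
  ... | true  = zerosThen-gain r _ x≥0
  ... | false = zerosThen-gain r _ x≥0

  closing-loses : ∀ r h {L} → L ≡ c + d → Loses c h L (toList (zerosThen r (U - d)))
  closing-loses zero h refl with A E (h ++ˡ [ U - d ]) ∧ (c + d + (U - d) ≤ᵇ 1ℚ) in packed
  ... | true  = ⊥-elim (<⇒≱ overflow (∧-fits⇒≤ (c + d) (U - d) packed))
    where
    overflow : 1ℚ < c + d + (U - d)
    overflow = <-byGap d d>0 (solve 2 (λ c d → c :+ d :+ (con 1ℚ :- c :+ d :- d) :- con 1ℚ := d) refl c d)
  ... | false = beaten (refl ∷ []) (≤-reflexive c+[U-d]≡1)
                  (subst (λ t → c + d < q * t) (sym c+[U-d]≡1) (beats-with-1 c+d<q))
  closing-loses (suc r) h {L} L≡c+d with A E (h ++ˡ [ 0ℚ ]) ∧ (L + 0ℚ ≤ᵇ 1ℚ)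
  ... | true  = pass (closing-loses r _ (trans (+-identityʳ L) L≡c+d))
  ... | false = pass (closing-loses r _ L≡c+d)

  small-loses : ∀ r h {L} i → L ≡ c → i +ℕ r ≡ n →
    Loses c h L (toList (smallPhase r h L)) ⊎ Loses (fromℕ i * d) h L (toList (smallPhase r h L))
  small-loses zero h i L≡c i+0≡n with trans (sym (ℕ.+-identityʳ i)) i+0≡n
  small-loses zero h {L} i refl _ | refl with A E (h ++ˡ [ U ]) ∧ (c + U ≤ᵇ 1ℚ) in packed
  ... | true  = ⊥-elim (<⇒≱ overflow (∧-fits⇒≤ c U packed))
    where
    overflow : 1ℚ < c + U
    overflow = <-byGap d d>0 (solve 2 (λ c d → c :+ (con 1ℚ :- c :+ d) :- con 1ℚ := d) refl c d)
  ... | false = inj₂ (beaten (refl ∷ []) (≤-reflexive nd+U≡1)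
                        (subst (λ t → c < q * t) (sym nd+U≡1) (beats-with-1 c<q)))
  small-loses (suc r) h {L} i L≡c i+r+1≡n with A E (h ++ˡ [ d ]) ∧ (L + d ≤ᵇ 1ℚ)
  ... | true  = inj₁ (pass (closing-loses r _ (cong (_+ d) L≡c)))
  ... | false = Sum.map pass (λ G → take (beaten-cong (fromℕ-suc-* i d) G))
                  (small-loses r _ (suc i) L≡c (trans (sym (ℕ.+-suc i r)) i+r+1≡n))

  blocked-loses : ∀ r h {L} → L ≡ c →
    Loses c h L (toList (blockedPhase r h L)) ⊎ Loses 0ℚ h L (toList (blockedPhase r h L))
  blocked-loses zero h L≡c = Sum.map₂ (beaten-cong (*-zeroˡ d)) (small-loses n h 0 L≡c refl)
  blocked-loses (suc r) h {L} L≡c with A E (h ++ˡ [ v ]) ∧ (L + v ≤ᵇ 1ℚ) in packed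
  ... | false = Sum.map pass pass (blocked-loses r _ L≡c)
  ... | true with v-blocked
  ...   | inj₁ c+v>1 = ⊥-elim (<⇒≱ c+v>1 (subst (λ t → t + v ≤ 1ℚ) L≡c (∧-fits⇒≤ L v packed)))
  ...   | inj₂ v≡0 = Sum.map pass pass (blocked-loses r _ (trans (cong (λ x → L + x) v≡0) (trans (+-identityʳ L) L≡c)))

  large-loses : ∀ r h j → j +ℕ r ≡ k →
    Loses 0ℚ h 0ℚ (toList (largePhase r h)) ⊎ Loses (fromℕ j * c) h 0ℚ (toList (largePhase r h))
  large-loses zero h j j+0≡k with trans (sym (ℕ.+-identityʳ j)) j+0≡k
  ... | refl = inj₂ (beaten-by-prefix kc≤1 (≤-<-trans (zerosThen-gain n h U-2δ≥0) rejecting-loses))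
  large-loses (suc r) h j j+r+1≡k with A E (h ++ˡ [ c ]) ∧ (0ℚ + c ≤ᵇ 1ℚ)
  ... | true  = inj₁ ([ take ∘ beaten-cong (sym (+-identityˡ c)) , pass ]′ (blocked-loses r _ (+-identityˡ c)))
  ... | false = Sum.map pass (λ G → take (beaten-cong (fromℕ-suc-* j c) G))
                  (large-loses r _ (suc j) (trans (sym (ℕ.+-suc j r)) j+r+1≡k))

  gain<q*OPT : gain A estimates actual < q * OPT actual
  gain<q*OPT = [ fromBeaten , fromBeaten ∘ beaten-cong (*-zeroˡ c) ]′ (large-loses k [] 0 refl)
    where
    fromBeaten : Loses 0ℚ [] 0ℚ (toList actual) → gain A estimates actual < q * OPT actual
    fromBeaten (beaten {s} s⊆act fits beats) =
      <-≤-trans (subst (λ t → _ < q * t) (+-identityˡ (sumℚ s)) beats)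
        (*-monoˡ-≤-nonNeg q {{nonNegative q≥0}} (≤OPT actual s⊆act (subst (_≤ 1ℚ) (+-identityˡ (sumℚ s)) fits)))

  0-valid : ValidItem δ δ 0ℚ
  0-valid = ≤-refl , 0≤1 , ≤-reflexive (+-inverseʳ δ) , 2δ≥0

  d-valid : ValidItem δ δ d
  d-valid = d≥0 , ≤-trans d≤c c≤1 , subst (_≤ d) (sym (+-inverseʳ δ)) d≥0 , d≤2δ

  U-valid : ValidItem δ (U - δ) U
  U-valid =
    ≤-byGap _ (+-mono-≤ (p≤q⇒0≤q-p c≤1) d≥0) (solve 2 (λ c d → con 1ℚ :- c :+ d :- con 0ℚ := (con 1ℚ :- c) :+ d) refl c d) ,
    ≤-byGap _ (p≤q⇒0≤q-p d≤c) (solve 2 (λ c d → con 1ℚ :- (con 1ℚ :- c :+ d) := c :- d) refl c d) ,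
    ≤-byGap _ 2δ≥0 (solve 2 (λ u δ → u :- (u :- δ :- δ) := δ :+ δ) refl U δ) ,
    ≤-reflexive (solve 2 (λ u δ → u := u :- δ :+ δ) refl U δ)

  U-d-valid : ValidItem δ (U - δ) (U - d)
  U-d-valid =
    ≤-byGap _ (p≤q⇒0≤q-p c≤1) (solve 2 (λ c d → con 1ℚ :- c :+ d :- d :- con 0ℚ := con 1ℚ :- c) refl c d) ,
    ≤-byGap _ c≥0 (solve 2 (λ c d → con 1ℚ :- (con 1ℚ :- c :+ d :- d) := c) refl c d) ,
    ≤-byGap _ (p≤q⇒0≤q-p d≤2δ) (solve 3 (λ u δ d → u :- d :- (u :- δ :- δ) := δ :+ δ :- d) refl U δ d) ,
    ≤-byGap _ d≥0 (solve 3 (λ u δ d → u :- δ :+ δ :- (u :- d) := d) refl U δ d)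

  U-2δ-valid : ValidItem δ (U - δ) (U - (δ + δ))
  U-2δ-valid =
    U-2δ≥0 ,
    ≤-trans (≤-byGap _ 2δ≥0 (solve 2 (λ u δ → u :- (u :- (δ :+ δ)) := δ :+ δ) refl U δ)) (proj₁ (proj₂ U-valid)) ,
    ≤-reflexive (solve 2 (λ u δ → u :- δ :- δ := u :- (δ :+ δ)) refl U δ) ,
    ≤-byGap _ 2δ≥0 (solve 2 (λ u δ → u :- δ :+ δ :- (u :- (δ :+ δ)) := δ :+ δ) refl U δ)

  ValidItems : ∀ {m} → Vec ℚ m → Vec ℚ m → Set
  ValidItems = Pointwise (ValidItem δ)

  zerosThen-valid : ∀ r {x} → ValidItem δ (U - δ) x → ValidItems (replicate r δ ++ᵛ [ U - δ ]ᵛ) (zerosThen r x)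
  zerosThen-valid zero    x-valid = x-valid ∷ []
  zerosThen-valid (suc r) x-valid = 0-valid ∷ zerosThen-valid r x-valid

  small-valid : ∀ r h L → ValidItems (replicate r δ ++ᵛ [ U - δ ]ᵛ) (smallPhase r h L)
  small-valid zero    h L = U-valid ∷ []
  small-valid (suc r) h L with A E (h ++ˡ [ d ]) ∧ (L + d ≤ᵇ 1ℚ)
  ... | true  = d-valid ∷ zerosThen-valid r U-d-valid
  ... | false = d-valid ∷ small-valid r _ L

  blocked-valid : ∀ r h L → ValidItems (replicate r e ++ᵛ (replicate n δ ++ᵛ [ U - δ ]ᵛ)) (blockedPhase r h L)
  blocked-valid zero    h L = small-valid n h L
  blocked-valid (suc r) h L = v-valid ∷ blocked-valid r _ _

  large-valid : ∀ r h → ValidItems (replicate r e ++ᵛ (replicate n δ ++ᵛ [ U - δ ]ᵛ)) (largePhase r h)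
  large-valid zero    h = zerosThen-valid n U-2δ-valid
  large-valid (suc r) h with A E (h ++ˡ [ c ]) ∧ (0ℚ + c ≤ᵇ 1ℚ)
  ... | true  = c-valid ∷ blocked-valid r _ _
  ... | false = c-valid ∷ large-valid r _

  valid : (i : Fin (k +ℕ (n +ℕ 1))) → ValidItem δ (lookup estimates i) (lookup actual i)
  valid = Pointwise.lookup (large-valid k [])

record LargeItem (δ q : ℚ) (k : ℕ) : Set where
  field
    c v e : ℚ
    c>0 : 0ℚ < c
    c<1-2δ : c < 1ℚ - (δ + δ)
    c<q : c < q
    kc<1 : fromℕ k * c < 1ℚ
    1-2δ<c[1+qk] : 1ℚ - (δ + δ) < c * (1ℚ + q * fromℕ k)
    v-blocked : 1ℚ < c + v ⊎ v ≡ 0ℚ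
    c-valid : ValidItem δ e c
    v-valid : ValidItem δ e v

module _ {δ q : ℚ} {k : ℕ} (L : LargeItem δ q k) where
  open LargeItem L

  excess : ℚ
  excess = c * (1ℚ + q * fromℕ k) - (1ℚ - (δ + δ))

  slack : ℚ
  slack = (δ + δ) ⊓ (q - c) ⊓ excess

  slack≤2δ : slack ≤ δ + δ
  slack≤2δ = ≤-trans (p⊓q≤p ((δ + δ) ⊓ (q - c)) excess) (p⊓q≤p (δ + δ) (q - c))

  slack≤q-c : slack ≤ q - c
  slack≤q-c = ≤-trans (p⊓q≤p ((δ + δ) ⊓ (q - c)) excess) (p⊓q≤q (δ + δ) (q - c))

  slack≤excess : slack ≤ excess
  slack≤excess = p⊓q≤q ((δ + δ) ⊓ (q - c)) excess

  slack>0 : 0ℚ < δ → 0ℚ < slack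
  slack>0 δ>0 = <-⊓ (<-⊓ (+-mono-< δ>0 δ>0) (p<q⇒0<q-p c<q)) (p<q⇒0<q-p 1-2δ<c[1+qk])

  withSmallItem : ∀ n z → fromℕ (suc n) * z ≡ 1ℚ → 0ℚ < z → z < slack → Parameters δ q k
  withSmallItem n z [n+1]z≡1 z>0 z<slack = record
    { c = c ; d = d ; v = v ; e = e ; n = n
    ; d>0 = *-pos c>0 z>0
    ; d≤2δ = <⇒≤ (<-≤-trans d<slack slack≤2δ)
    ; c≤1-2δ = <⇒≤ c<1-2δ
    ; [n+1]d≡c = begin
        fromℕ (suc n) * (c * z)  ≡⟨ solve 3 (λ m c z → m :* (c :* z) := c :* (m :* z)) refl (fromℕ (suc n)) c z ⟩
        c * (fromℕ (suc n) * z)  ≡⟨ cong (c *_) [n+1]z≡1 ⟩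
        c * 1ℚ                   ≡⟨ *-identityʳ c ⟩
        c                        ∎
    ; c+d<q = <-byGap (q - c - d) (p<q⇒0<q-p (<-≤-trans d<slack slack≤q-c))
                (solve 3 (λ q c d → q :- (c :+ d) := q :- c :- d) refl q c d)
    ; kc≤1 = <⇒≤ kc<1
    ; rejecting-loses = <-byGap (excess - d) (p<q⇒0<q-p (<-≤-trans d<slack slack≤excess))
        (solve 5 (λ q k c d δ → q :* (k :* c) :- (con 1ℚ :- c :+ d :- (δ :+ δ))
                               := c :* (con 1ℚ :+ q :* k) :- (con 1ℚ :- (δ :+ δ)) :- d) refl q (fromℕ k) c d δ)
    ; v-blocked = v-blocked
    ; c-valid = c-valid
    ; v-valid = v-valid
    }
    where
    open ≡-Reasoning
    d : ℚ
    d = c * z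
    d<slack : d < slack
    d<slack = ≤-<-trans (≤-byGap _ (*-nonNeg (p≤q⇒0≤q-p (proj₁ (proj₂ c-valid))) (<⇒≤ z>0))
                          (solve 2 (λ c z → z :- c :* z := (con 1ℚ :- c) :* z) refl c z)) z<slack

  refine : 0ℚ < δ → Parameters δ q k
  refine δ>0 with unitFraction-< (slack>0 δ>0)
  ... | n , z , [n+1]z≡1 , z>0 , z<slack = withSmallItem n z [n+1]z≡1 z>0 z<slack

fromℕ-*-pos⇒pos : ∀ n {x} → 0ℚ < fromℕ n * x → 0ℚ < fromℕ n
fromℕ-*-pos⇒pos zero    {x} 0<0x = ⊥-elim (<-irrefl (sym (*-zeroˡ x)) 0<0x)
fromℕ-*-pos⇒pos (suc n) _       = 0<fromℕ-suc n

3≤fromℕ : ∀ k {m} → 0ℚ ≤ m → m < 1ℚ → fromℕ k * m ≡ fromℕ 2 → fromℕ 3 ≤ fromℕ k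
3≤fromℕ k {m} m≥0 m<1 km≡2 with ℕ.≤-<-connex 3 k
... | inj₁ 3≤k = fromℕ-mono-≤ 3≤k
... | inj₂ k<3 = ⊥-elim (<-irrefl km≡2 km<2)
  where
  km<2 : fromℕ k * m < fromℕ 2
  km<2 = ≤-<-trans (*-monoʳ-≤-nonNeg m {{nonNegative m≥0}} (fromℕ-mono-≤ (ℕ.≤-pred k<3)))
                   (subst (fromℕ 2 * m <_) (*-identityʳ (fromℕ 2)) (*-monoʳ-<-pos (fromℕ 2) m<1))

module LargeItemChoice {δ q : ℚ} {k : ℕ} (δ>0 : 0ℚ < δ) (δ<½ : δ < ½)
  (km≤2 : fromℕ k * (1ℚ - (δ + δ)) ≤ fromℕ 2)
  (2<[k+1]m : fromℕ 2 < (fromℕ k + 1ℚ) * (1ℚ - (δ + δ)))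
  (q>0 : 0ℚ < q) (m<quad : 1ℚ - (δ + δ) < quad (fromℕ k) q) where

  m K P : ℚ
  m = 1ℚ - (δ + δ)
  K = fromℕ k
  P = 1ℚ + q * K

  m>0 : 0ℚ < m
  m>0 = p<q⇒0<q-p (+-mono-< δ<½ δ<½)

  m<1 : m < 1ℚ
  m<1 = <-byGap (δ + δ) (+-mono-< δ>0 δ>0) (solve 1 (λ δ → con 1ℚ :- (con 1ℚ :- (δ :+ δ)) := δ :+ δ) refl δ)

  1<Km : 1ℚ < K * m
  1<Km = <-byGap _ (+-mono-< (p<q⇒0<q-p 2<[k+1]m) (p<q⇒0<q-p m<1))
    (solve 2 (λ K m → K :* m :- con 1ℚ := (K :+ con 1ℚ) :* m :- con (fromℕ 2) :+ (con 1ℚ :- m)) refl K m)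

  K>0 : 0ℚ < K
  K>0 = fromℕ-*-pos⇒pos k {m} (<-trans (positive⁻¹ 1ℚ) 1<Km)

  P>0 : 0ℚ < P
  P>0 = +-mono-<-≤ (positive⁻¹ 1ℚ) (*-nonNeg (<⇒≤ q>0) (<⇒≤ K>0))

  -- The next two facts are where q > p, the positive root of K x² + x = m, is used.
  Km<P : K * m < P
  Km<P = <-byGap _ (p<q⇒0<q-p Km-1<qK) (solve 3 (λ K m q → con 1ℚ :+ q :* K :- K :* m := q :* K :- (K :* m :- con 1ℚ)) refl K m q)
    where
    quad[Km-1]≤Km : quad 1ℚ (K * m - 1ℚ) ≤ K * m
    quad[Km-1]≤Km = ≤-byGap _ (*-nonNeg (<⇒≤ (<-trans (positive⁻¹ 1ℚ) 1<Km)) (p≤q⇒0≤q-p km≤2))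
      (solve 1 (λ x → x :- (con 1ℚ :* ((x :- con 1ℚ) :* (x :- con 1ℚ)) :+ (x :- con 1ℚ)) := x :* (con (fromℕ 2) :- x)) refl (K * m))
    Km<quad[qK] : K * m < quad 1ℚ (q * K)
    Km<quad[qK] = subst (K * m <_) (solve 2 (λ K q → K :* (K :* (q :* q) :+ q) := con 1ℚ :* ((q :* K) :* (q :* K)) :+ q :* K) refl K q)
                    (*-monoʳ-<-pos K {{positive K>0}} m<quad)
    Km-1<qK : K * m - 1ℚ < q * K
    Km-1<qK = quad-cancel-< 0≤1 (*-nonNeg (<⇒≤ q>0) (<⇒≤ K>0)) (≤-<-trans quad[Km-1]≤Km Km<quad[qK])

  m½<q : m * ½ < q
  m½<q = quad-cancel-< (0≤fromℕ k) (<⇒≤ q>0) (≤-<-trans quad[m½]≤m m<quad)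
    where
    quad[m½]≤m : quad K (m * ½) ≤ m
    quad[m½]≤m = ≤-byGap _ (*-nonNeg (*-nonNeg (<⇒≤ m>0) (nonNegative⁻¹ (½ * ½))) (p≤q⇒0≤q-p km≤2))
      (solve 2 (λ K m → m :- (K :* ((m :* con ½) :* (m :* con ½)) :+ m :* con ½) := m :* (con ½ :* con ½) :* (con (fromℕ 2) :- K :* m)) refl K m)

  m/P : ℚ
  m/P = divide P>0 m

  1/K : ℚ
  1/K = divide K>0 1ℚ

  m/P<q : m/P < q
  m/P<q = divide-< P>0 (subst (m <_) (solve 2 (λ K q → K :* (q :* q) :+ q := q :* (con 1ℚ :+ q :* K)) refl K q) m<quad)

  m/P<1/K : m/P < 1/K
  m/P<1/K = <-divide K>0 (subst (_< 1ℚ) (sym (divide-*-comm P>0 m K))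
              (divide-< P>0 (subst₂ _<_ (*-comm K m) (sym (*-identityˡ P)) Km<P)))

  module Between (c : ℚ) (m/P<c : m/P < c) (c<q : c < q) (c<1/K : c < 1/K) where

    m<cP : m < c * P
    m<cP = divide-<⁻¹ P>0 m/P<c

    Kc<1 : K * c < 1ℚ
    Kc<1 = subst (_< 1ℚ) (*-comm c K) (<-divide⁻¹ K>0 c<1/K)

    c>0 : 0ℚ < c
    c>0 = *-cancelʳ-<-nonNeg P {{nonNegative (<⇒≤ P>0)}} (subst (_< c * P) (sym (*-zeroˡ P)) (<-trans m>0 m<cP))

    c<m : c < m
    c<m = *-cancelˡ-<-nonNeg K {{nonNegative (<⇒≤ K>0)}} (<-trans Kc<1 1<Km)

    c≤1 : c ≤ 1ℚ
    c≤1 = <⇒≤ (<-trans c<m m<1)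

    mkLargeItem : ∀ v e → 1ℚ < c + v ⊎ v ≡ 0ℚ → ValidItem δ e c → ValidItem δ e v → LargeItem δ q k
    mkLargeItem v e v-blocked c-valid v-valid = record
      { c = c ; v = v ; e = e ; c>0 = c>0 ; c<1-2δ = c<m ; c<q = c<q ; kc<1 = Kc<1 ; 1-2δ<c[1+qk] = m<cP
      ; v-blocked = v-blocked ; c-valid = c-valid ; v-valid = v-valid }

  m½<1/K : K * m < fromℕ 2 → m * ½ < 1/K
  m½<1/K Km<2 = <-divide K>0 {q = 1ℚ} (<-byGap _ (*-pos (p<q⇒0<q-p Km<2) (positive⁻¹ ½))
    (solve 2 (λ K m → con 1ℚ :- m :* con ½ :* K := (con (fromℕ 2) :- K :* m) :* con ½) refl K m))

  -- When K m < 2 we take c > m/2, so that a second large item c + 2δ no longer fits next to c.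
  largeItem-Km<2 : K * m < fromℕ 2 → LargeItem δ q k
  largeItem-Km<2 Km<2 = above (<-dense (⊔-< (<-⊓ m/P<q m/P<1/K) (<-⊓ m½<q (m½<1/K Km<2))))
    where
    above : ∃[ c ] m/P ⊔ m * ½ < c × c < q ⊓ 1/K → LargeItem δ q k
    above (c , lo<c , c<hi) = mkLargeItem (c + (δ + δ)) (c + δ) (inj₁ blocked) c-valid v-valid
      where
      open Between c (≤-<-trans (p≤p⊔q m/P (m * ½)) lo<c) (<-≤-trans c<hi (p⊓q≤p q 1/K)) (<-≤-trans c<hi (p⊓q≤q q 1/K))
      m½<c : m * ½ < c
      m½<c = ≤-<-trans (p≤q⊔p m/P (m * ½)) lo<c
      blocked : 1ℚ < c + (c + (δ + δ))
      blocked = <-byGap _ (+-mono-< (p<q⇒0<q-p m½<c) (p<q⇒0<q-p m½<c))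
        (solve 2 (λ c δ → c :+ (c :+ (δ :+ δ)) :- con 1ℚ := c :- (con 1ℚ :- (δ :+ δ)) :* con ½ :+ (c :- (con 1ℚ :- (δ :+ δ)) :* con ½)) refl c δ)
      c-valid : ValidItem δ (c + δ) c
      c-valid = <⇒≤ c>0 , c≤1 , ≤-reflexive (solve 2 (λ c δ → c :+ δ :- δ := c) refl c δ) ,
                ≤-byGap _ (<⇒≤ (+-mono-< δ>0 δ>0)) (solve 2 (λ c δ → c :+ δ :+ δ :- c := δ :+ δ) refl c δ)
      v-valid : ValidItem δ (c + δ) (c + (δ + δ))
      v-valid = +-mono-≤ (<⇒≤ c>0) (<⇒≤ (+-mono-< δ>0 δ>0)) ,
                ≤-byGap _ (p≤q⇒0≤q-p (<⇒≤ c<m)) (solve 2 (λ c δ → con 1ℚ :- (c :+ (δ :+ δ)) := con 1ℚ :- (δ :+ δ) :- c) refl c δ) ,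
                ≤-byGap _ (<⇒≤ (+-mono-< δ>0 δ>0)) (solve 2 (λ c δ → c :+ (δ :+ δ) :- (c :+ δ :- δ) := δ :+ δ) refl c δ) ,
                ≤-reflexive (solve 2 (λ c δ → c :+ (δ :+ δ) := c :+ δ :+ δ) refl c δ)

  -- When K m = 2 the large item is at most 2δ, so the later large items can shrink to 0.
  largeItem-Km≡2 : K * m ≡ fromℕ 2 → LargeItem δ q k
  largeItem-Km≡2 Km≡2 = above (<-dense (<-⊓ m/P<q m/P<1/K))
    where
    above : ∃[ c ] m/P < c × c < q ⊓ 1/K → LargeItem δ q k
    above (c , m/P<c , c<hi) = mkLargeItem 0ℚ (c - δ) (inj₂ refl) c-valid v-valid
      where
      open Between c m/P<c (<-≤-trans c<hi (p⊓q≤p q 1/K)) (<-≤-trans c<hi (p⊓q≤q q 1/K))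
      1≤K2δ : 1ℚ ≤ K * (δ + δ)
      1≤K2δ = ≤-byGap (K - fromℕ 3) (p≤q⇒0≤q-p (3≤fromℕ k (<⇒≤ m>0) m<1 Km≡2)) (begin
        K * (δ + δ) - 1ℚ     ≡⟨ solve 2 (λ K δ → K :* (δ :+ δ) :- con 1ℚ := K :- K :* (con 1ℚ :- (δ :+ δ)) :- con 1ℚ) refl K δ ⟩
        K - K * m - 1ℚ       ≡⟨ cong (λ x → K - x - 1ℚ) Km≡2 ⟩
        K - fromℕ 2 - 1ℚ     ≡⟨ solve 1 (λ K → K :- con (fromℕ 2) :- con 1ℚ := K :- con (fromℕ 3)) refl K ⟩
        K - fromℕ 3          ∎)
        where open ≡-Reasoning
      c≤2δ : c ≤ δ + δ
      c≤2δ = <⇒≤ (*-cancelˡ-<-nonNeg K {{nonNegative (<⇒≤ K>0)}} (<-≤-trans Kc<1 1≤K2δ))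
      c-valid : ValidItem δ (c - δ) c
      c-valid = <⇒≤ c>0 , c≤1 , ≤-byGap _ (<⇒≤ (+-mono-< δ>0 δ>0)) (solve 2 (λ c δ → c :- (c :- δ :- δ) := δ :+ δ) refl c δ) ,
                ≤-reflexive (solve 2 (λ c δ → c := c :- δ :+ δ) refl c δ)
      v-valid : ValidItem δ (c - δ) 0ℚ
      v-valid = ≤-refl , 0≤1 , ≤-byGap _ (p≤q⇒0≤q-p c≤2δ) (solve 2 (λ c δ → con 0ℚ :- (c :- δ :- δ) := δ :+ δ :- c) refl c δ) ,
                subst (0ℚ ≤_) (solve 2 (λ c δ → c := c :- δ :+ δ) refl c δ) (<⇒≤ c>0)

  largeItem : LargeItem δ q k
  largeItem with <-cmp (K * m) (fromℕ 2)
  ... | tri< Km<2 _ _ = largeItem-Km<2 Km<2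
  ... | tri≈ _ Km≡2 _ = largeItem-Km≡2 Km≡2
  ... | tri> _ _ Km>2 = ⊥-elim (<⇒≱ Km>2 km≤2)

theorem4 : (δ : ℚ) → 0ℚ < δ → δ < ½ →
    (k : ℕ) → ((+ k) / 1) * (1ℚ - (δ + δ)) ≤ (+ 2) / 1 →
    (+ 2) / 1 < ((+ k) / 1 + 1ℚ) * (1ℚ - (δ + δ)) →
    (q : ℚ) → 0ℚ < q → 1ℚ - (δ + δ) < ((+ k) / 1) * (q * q) + q →
    (A : Algorithm) →
    Σ ℕ λ n → Σ (Vec ℚ n) λ est → Σ (Vec ℚ n) λ act →
      ((i : Fin n) → (0ℚ ≤ lookup act i) × (lookup act i ≤ 1ℚ)
                     × (lookup est i - δ ≤ lookup act i)
                     × (lookup act i ≤ lookup est i + δ))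
      × (gain A est act < q * OPT act)
theorem4 δ δ>0 δ<½ k km≤2 2<[k+1]m q q>0 m<kq²+q A = _ , estimates , actual , valid , gain<q*OPT
  where
  m : ℚ
  m = 1ℚ - (δ + δ)
  k≡ : + k / 1 ≡ fromℕ k
  k≡ = fromℕ≡/1 k
  large : LargeItem δ q k
  large = LargeItemChoice.largeItem δ>0 δ<½
    (subst (λ K → K * m ≤ fromℕ 2) k≡ km≤2)
    (subst (λ K → fromℕ 2 < (K + 1ℚ) * m) k≡ 2<[k+1]m)
    q>0
    (subst (λ K → m < K * (q * q) + q) k≡ m<kq²+q)
  open Adversary A (refine large δ>0)
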